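{- Let $\mathrm{M}$ be a loopless matroid of rank $r+1$ on a finite set $E$, and fix a linear order $<$ on $E$. For integers $s,t\ge 0$, the lexicographic expansion of $\alpha^s\beta^t$ (computed by first multiplying $1$ by $\beta$ successively $t$ times and then by $\alpha$ successively $s$ times, each time expanding lexicographically) is \[ \alpha^s\beta^t=\sum_{\mathcal{F}\,:\,|\mathcal{F}|=s+t,\ D(\mathcal{F})=[t]} x_{\mathcal{F}}, \] the sum ranging over all flags $\mathcal{F}$ of nonempty proper flats of $\mathrm{M}$ consisting of exactly $s+t$ flats whose descent set is exactly $[t]=\{1,\dots,t\}$. In particular this identity holds in the Chow ring $A(\mathrm{M})$.
   Context: The Chow ring $A(\mathrm{M})$ is the $\mathbb{R}$-algebra generated by variables $x_F$, one for each nonempty proper flat $F$ of $\mathrm{M}$ (i.e. $\emptyset\subsetneq F\subsetneq E$), subject to the relations $x_Fx_G=0$ whenever $F\not\subseteq G$ and $G\not\subseteq F$, and $\sum_{F\ni i}x_F=\sum_{F\ni j}x_F$ for all $i,j\in E$. For $i\in E$ put $\alpha_i=\sum_{F\ni i}x_F$ and $\beta_i=\sum_{F\not\ni i}x_F$ (sums over nonempty proper flats); their classes $\alpha,\beta\in A(\mathrm{M})$ do not depend on $i$. A flag is a chain $\mathcal{F}=\{\emptyset\subsetneq F_1\subsetneq\cdots\subsetneq F_k\subsetneq E\}$ of nonempty proper flats, with $|\mathcal{F}|=k$ and $x_{\mathcal{F}}=x_{F_1}\cdots x_{F_k}$; set $F_0=\emptyset$ and $F_{k+1}=E$ (so the empty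 flag has $F_1=E$). Lexicographic expansions: $x_{\mathcal{F}}\alpha$ is expanded as $x_{\mathcal{F}}\alpha_e=\sum_{F\supseteq F_k\cup e}x_{\mathcal{F}}x_F$ where $e=\min_<(E\setminus F_k)$ and $F$ ranges over nonempty proper flats containing $F_k\cup\{e\}$; $x_{\mathcal{F}}\beta$ is expanded as $x_{\mathcal{F}}\beta_e=\sum_{F\subseteq F_1\setminus e}x_Fx_{\mathcal{F}}$ where $e=\min_< F_1$ and $F$ ranges over nonempty flats contained in $F_1\setminus\{e\}$; the expansion of $x_{\mathcal{F}}\beta^t$ is obtained recursively by multiplying each monomial in the expansion of $x_{\mathcal{F}}\beta^{t-1}$ by $\beta$ lexicographically, and that of $x_{\mathcal{F}}\alpha^s\beta^t$ by multiplying each monomial of the expansion of $x_{\mathcal{F}}\alpha^{s-1}\beta^t$ by $\alpha$ lexicographically. The word of a flag $\mathcal{F}$ with $k$ flats is $m_1m_2\cdots m_{k+1}$ with $m_i=\min_<(F_i\setminus F_{i-1})$, and its descent set is $D(\mathcal{F})=\{i\in[k]: m_i>m_{i+1}\}$. -}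

module Defs where

open import Data.Nat as ℕ using (ℕ; zero; suc; _+_; _≤_; _<_; _<?_)
open import Data.Bool using (Bool; true; false)
open import Data.Fin using (Fin; zero; suc; toℕ)
open import Data.Fin.Subset
  using (Subset; _∈_; _∉_; _⊆_; _⊂_; _∪_; _∩_; _─_; ⁅_⁆; ∣_∣; Nonempty; ⊤; ⊥; ∁; _-_)
open import Data.Fin.Subset.Properties using (_∈?_; _⊆?_; nonempty?)
open import Data.Fin.Properties using (all?)
open import Data.Vec using (Vec; []; _∷_)
open import Data.Vec.Properties using (≡-dec)
import Data.Bool.Properties as BoolP
open import Data.List using (List; []; _∷_; _++_; [_]; map; filter; concatMap; head; last)
open import Data.List.Relation.Unary.All using (All)
open import Data.List.Relation.Unary.Linked using (Linked)
open import Data.Maybe using (Maybe; just; nothing) renaming (map to mapMaybe)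
open import Data.Product using (_×_)
open import Relation.Nullary using (Dec; ¬_; does; ¬?)
open import Relation.Nullary.Decidable using (_×-dec_; _→-dec_)
open import Relation.Binary.PropositionalEquality using (_≡_; _≢_)

-- Matroids on the ground set E = Fin n, given by their rank function
-- (standard rank axioms).  The linear order < on E is the standard
-- order of Fin n.

record Matroid (n : ℕ) : Set where
  field
    rk        : Subset n → ℕ
    rk-bound  : ∀ X → rk X ≤ ∣ X ∣
    rk-mono   : ∀ {X Y} → X ⊆ Y → rk X ≤ rk Y
    rk-submod : ∀ X Y → rk (X ∪ Y) + rk (X ∩ Y) ≤ rk X + rk Y

open Matroid public

module _ {n : ℕ} (M : Matroid n) where

  Loopless : Set
  Loopless = ∀ e → 0 < rk M ⁅ e ⁆

  IsFlat : Subset n → Set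
  IsFlat X = ∀ e → e ∉ X → rk M X < rk M (X ∪ ⁅ e ⁆)

  isFlat? : ∀ X → Dec (IsFlat X)
  isFlat? X = all? (λ e → ¬? (e ∈? X) →-dec (rk M X <? rk M (X ∪ ⁅ e ⁆)))

allSubsets : ∀ n → List (Subset n)
allSubsets zero    = [] ∷ []
allSubsets (suc n) = map (true ∷_) (allSubsets n) ++ map (false ∷_) (allSubsets n)

_≟ˢ_ : ∀ {n} (X Y : Subset n) → Dec (X ≡ Y)
_≟ˢ_ = ≡-dec BoolP._≟_

minElem : ∀ {n} → Subset n → Maybe (Fin n)
minElem []          = nothing
minElem (true ∷ X)  = just zero
minElem (false ∷ X) = mapMaybe suc (minElem X)

-- A flag F₁ ⊊ ⋯ ⊊ F_k is represented by the list [F₁, …, F_k].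
Flag : ℕ → Set
Flag n = List (Subset n)

-- Formal sums of flag monomials x_𝓕 (with multiplicity) as lists of flags.
FormalSum : ℕ → Set
FormalSum n = List (Flag n)

module _ {n : ℕ} (M : Matroid n) where

  NonemptyProperFlat : Subset n → Set
  NonemptyProperFlat X = IsFlat M X × Nonempty X × X ≢ ⊤

  nonemptyProperFlat? : ∀ X → Dec (NonemptyProperFlat X)
  nonemptyProperFlat? X = isFlat? M X ×-dec (nonempty? X ×-dec ¬? (X ≟ˢ ⊤))

  NonemptyFlat : Subset n → Set
  NonemptyFlat X = IsFlat M X × Nonempty X

  nonemptyFlat? : ∀ X → Dec (NonemptyFlat X)
  nonemptyFlat? X = isFlat? M X ×-dec nonempty? X

  IsFlag : Flag n → Set
  IsFlag L = All NonemptyProperFlat L × Linked _⊂_ L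

  -- F_k (with F_0 = ∅ for the empty flag) and F_1 (with F_1 = E for the empty flag).
  lastFlat : Flag n → Subset n
  lastFlat L with last L
  ... | just F  = F
  ... | nothing = ⊥

  firstFlat : Flag n → Subset n
  firstFlat L with head L
  ... | just F  = F
  ... | nothing = ⊤

  -- x_𝓕 α, expanded lexicographically: e = min(E ∖ F_k),
  -- sum over nonempty proper flats F ⊇ F_k ∪ e.
  mulα : Flag n → FormalSum n
  mulα L with minElem (∁ (lastFlat L))
  ... | nothing = []
  ... | just e  = map (λ F → L ++ [ F ])
                      (filter (λ F → (lastFlat L ∪ ⁅ e ⁆) ⊆? F)
                        (filter nonemptyProperFlat? (allSubsets n)))

  -- x_𝓕 β, expanded lexicographically: e = min F_1,
  -- sum over nonempty flats F ⊆ F_1 ∖ e.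
  mulβ : Flag n → FormalSum n
  mulβ L with minElem (firstFlat L)
  ... | nothing = []
  ... | just e  = map (λ F → F ∷ L)
                      (filter (λ F → F ⊆? (firstFlat L - e))
                        (filter nonemptyFlat? (allSubsets n)))

  iterα : ℕ → FormalSum n → FormalSum n
  iterα zero    S = S
  iterα (suc s) S = concatMap mulα (iterα s S)

  iterβ : ℕ → FormalSum n → FormalSum n
  iterβ zero    S = S
  iterβ (suc t) S = concatMap mulβ (iterβ t S)

  -- Lexicographic expansion of α^s β^t: start from 1 (the empty flag),
  -- multiply by β t times, then by α s times.
  lexExpansion : ℕ → ℕ → FormalSum n
  lexExpansion s t = iterα s (iterβ t ([] ∷ []))

-- Word m₁ ⋯ m_{k+1} of a flag, m_i = min(F_i ∖ F_{i-1}), F_0 = ∅, F_{k+1} = E.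
wordFrom : ∀ {n} → Subset n → Flag n → List (Maybe (Fin n))
wordFrom prev []      = minElem (⊤ ─ prev) ∷ []
wordFrom prev (F ∷ L) = minElem (F ─ prev) ∷ wordFrom F L

word : ∀ {n} → Flag n → List (Maybe (Fin n))
word = wordFrom ⊥

-- Descent indicator of a word: the i-th entry is true iff m_i > m_{i+1}
-- (i = 1, …, k).  So D(𝓕) = {i : i-th entry is true}.
isDescent : ∀ {n} → Maybe (Fin n) → Maybe (Fin n) → Bool
isDescent (just a) (just b) = does (toℕ b <? toℕ a)
isDescent _        _        = false

descents : ∀ {n} → List (Maybe (Fin n)) → List Bool
descents []           = []
descents (a ∷ [])     = []
descents (a ∷ b ∷ w)  = isDescent a b ∷ descents (b ∷ w)

{-# OPTIONS --safe #-}
module Submission where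

-- Each lexicographic product adds one flat to a flag, and the rule choosing it is a
-- condition on a single letter of the word.  Multiplying by β prepends a flat F ⊆ F₁ ∖ e
-- with e = min F₁, i.e. a flat F ⊊ F₁ avoiding min F₁; as min F₁ is the smaller of min F
-- and min (F₁ ∖ F), this says exactly that the new first letter min F exceeds the next one,
-- min (F₁ ∖ F) = min F₁: a descent appears at position 1 and the rest of the word is
-- unchanged.  Dually, multiplying by α appends F ⊇ F_k ∪ e with e = min (E ∖ F_k); splitting
-- E ∖ F_k into F ∖ F_k and E ∖ F, this says that the new letter min (F ∖ F_k) = min (E ∖ F_k)
-- is below min (E ∖ F): an ascent at the end.  Induction gives the descent set [t], and no
-- flag is produced twice because it determines the flag it came from.

open import Defs
open import Data.Bool using (true; false; T)
open import Data.Unit using (tt)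
open import Data.Nat using (ℕ; zero; suc; _+_; _≤_; _<_; _<?_; z≤n; s≤s)
open import Data.Nat.Properties
  using (≤-trans; ≤-antisym; <⇒≤; ≤⇒≯; ≮⇒≥; ≤∧≢⇒<; <ᵇ⇒<; <⇒<ᵇ; suc-injective; +-comm)
open import Data.Fin using (Fin; toℕ)
open import Data.Fin.Properties using (toℕ-injective)
open import Data.Fin.Subset
  using (Subset; _⊆_; _⊂_; _∪_; _─_; _-_; ⁅_⁆; Nonempty; ⊤; ⊥; ∁; inside; outside)
  renaming (_∈_ to _∈ˢ_; _∉_ to _∉ˢ_)
open import Data.Fin.Subset.Properties
  using ( _∈?_; _⊆?_; nonempty?; ∈⊤; ⊆⊤; ⊥⊆; ∉⊥; ⊆-antisym; x∈⁅x⁆; x∈⁅y⁆⇒x≡y; x∈p∪q⁺; x∈p∪q⁻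
        ; x∉∁p⇒x∈p; p─⊥≡p; p─q⊆p; x∈p∧x∉q⇒x∈p─q; x∈p∧x≢y⇒x∈p-y)
open import Data.Vec using ([]; _∷_; here; there)
import Data.Vec.Properties as Vec
open import Data.List
  using (List; []; _∷_; [_]; _++_; _∷ʳ_; length; replicate; last; map; filter; concatMap
        ; initLast; _∷ʳ′_)
open import Data.List.Properties
  using ( ∷-injective; ∷-injectiveˡ; ∷-injectiveʳ; ∷ʳ-injective; ∷ʳ-injectiveˡ; ∷ʳ-injectiveʳ
        ; ++-assoc; length-++)
open import Data.List.Membership.Propositional using (_∈_; find; lose)
open import Data.List.Membership.Propositional.Properties
  using (∈-map⁺; ∈-map⁻; ∈-++⁺ˡ; ∈-++⁺ʳ; ∈-filter⁺; ∈-filter⁻; ∈-concatMap⁺; ∈-concatMap⁻)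
open import Data.List.Relation.Unary.All using (All; []; _∷_; universal)
import Data.List.Relation.Unary.All.Properties as All
open import Data.List.Relation.Unary.AllPairs as AllPairs using ([]; _∷_)
import Data.List.Relation.Unary.AllPairs.Properties as AllPairs
open import Data.List.Relation.Unary.Any using (here; there)
open import Data.List.Relation.Unary.Linked using (Linked; []; [-]; _∷_)
open import Data.List.Relation.Unary.Unique.Propositional using (Unique)
import Data.List.Relation.Unary.Unique.Propositional.Properties as Unique
open import Data.Maybe using (Maybe; just; nothing)
open import Data.Product using (_×_; _,_; proj₁; proj₂; ∃; ∃₂)
open import Data.Sum using (_⊎_; inj₁; inj₂; [_,_]′)
open import Function using (_∘_)
open import Function.Bundles using (_⇔_; mk⇔; Equivalence)
open import Relation.Nullary using (yes; no; ¬_; contradiction)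
open import Relation.Nullary.Decidable using (dec-true; dec-false)
open import Relation.Binary.PropositionalEquality
  using (_≡_; _≢_; refl; sym; trans; cong; cong₂; subst; module ≡-Reasoning)

private variable
  n : ℕ
  A B : Set

-- Subsets and their minima

x∈p─q⇒x∉q : {p q : Subset n} {x : Fin n} → x ∈ˢ p ─ q → x ∉ˢ q
x∈p─q⇒x∉q {p = inside ∷ p} {outside ∷ q} here ()
x∈p─q⇒x∉q {p = _ ∷ p} {_ ∷ q} (there x∈p─q) (there x∈q) = x∈p─q⇒x∉q x∈p─q x∈q

⊤─p≡∁p : (p : Subset n) → ⊤ ─ p ≡ ∁ p
⊤─p≡∁p []            = refl
⊤─p≡∁p (inside ∷ p)  = cong (outside ∷_) (⊤─p≡∁p p)
⊤─p≡∁p (outside ∷ p) = cong (inside ∷_) (⊤─p≡∁p p)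

p⊂q⇒p≢⊤ : {p q : Subset n} → p ⊂ q → p ≢ ⊤
p⊂q⇒p≢⊤ (_ , x , _ , x∉p) refl = x∉p ∈⊤

p≢⊤⇒p⊂⊤ : {p : Subset n} → p ≢ ⊤ → p ⊂ ⊤
p≢⊤⇒p⊂⊤ {p = p} p≢⊤ with nonempty? (∁ p)
... | yes (x , x∈∁p) = ⊆⊤ , x , ∈⊤ , λ x∈p → x∈p─q⇒x∉q (subst (x ∈ˢ_) (sym (⊤─p≡∁p p)) x∈∁p) x∈p
... | no ∁p-empty    =
  contradiction (⊆-antisym ⊆⊤ λ {x} _ → x∉∁p⇒x∈p (λ x∈∁p → ∁p-empty (x , x∈∁p))) p≢⊤

p⊂q⇒q─p≢∅ : {p q : Subset n} → p ⊂ q → Nonempty (q ─ p)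
p⊂q⇒q─p≢∅ (_ , x , x∈q , x∉p) = x , x∈p∧x∉q⇒x∈p─q x∈q x∉p

minElem-∈ : (X : Subset n) {e : Fin n} → minElem X ≡ just e → e ∈ˢ X
minElem-∈ (inside ∷ X)  refl = here
minElem-∈ (outside ∷ X) eq with minElem X in eqX
minElem-∈ (outside ∷ X) refl | just _ = there (minElem-∈ X eqX)

minElem-≤ : (X : Subset n) {e y : Fin n} → minElem X ≡ just e → y ∈ˢ X → toℕ e ≤ toℕ y
minElem-≤ (inside ∷ X)  refl _ = z≤n
minElem-≤ (outside ∷ X) eq (there y∈X) with minElem X in eqX
minElem-≤ (outside ∷ X) refl (there y∈X) | just _ = s≤s (minElem-≤ X eqX y∈X)

minElem-just : (X : Subset n) → Nonempty X → ∃ λ e → minElem X ≡ just e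
minElem-just (inside ∷ X)  _ = _ , refl
minElem-just (outside ∷ X) (_ , there y∈X) with minElem-just X (_ , y∈X)
... | e , eq rewrite eq = _ , refl

minElem-unique : (X : Subset n) {e : Fin n} → e ∈ˢ X → (∀ {y} → y ∈ˢ X → toℕ e ≤ toℕ y) →
                 minElem X ≡ just e
minElem-unique X e∈X e≤X with minElem-just X (_ , e∈X)
... | _ , eq = trans eq (cong just (toℕ-injective (≤-antisym
                  (minElem-≤ X eq e∈X) (e≤X (minElem-∈ X eq)))))

minElem-cover : (X Y Z : Subset n) {a b : Fin n} → (∀ {y} → y ∈ˢ Z → y ∈ˢ X ⊎ y ∈ˢ Y) → a ∈ˢ Z →
                minElem X ≡ just a → minElem Y ≡ just b → toℕ a ≤ toℕ b → minElem Z ≡ just a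
minElem-cover X Y Z cover a∈Z minX minY a≤b =
  minElem-unique Z a∈Z ([ minElem-≤ X minX , ≤-trans a≤b ∘ minElem-≤ Y minY ]′ ∘ cover)

isDescent-true : {a b : Fin n} → toℕ b < toℕ a → isDescent (just a) (just b) ≡ true
isDescent-true {a = a} {b} = dec-true (toℕ b <? toℕ a)

isDescent-false : {a b : Fin n} → toℕ a ≤ toℕ b → isDescent (just a) (just b) ≡ false
isDescent-false {a = a} {b} a≤b = dec-false (toℕ b <? toℕ a) (≤⇒≯ a≤b)

-- isDescent (just a) (just b) computes to the boolean toℕ b <ᵇ toℕ a.
isDescent-true⁻ : (x y : Maybe (Fin n)) → isDescent x y ≡ true →
                  ∃₂ λ a b → x ≡ just a × y ≡ just b × toℕ b < toℕ a
isDescent-true⁻ (just a) (just b) eq =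
  a , b , refl , refl , <ᵇ⇒< (toℕ b) (toℕ a) (subst T (sym eq) tt)

isDescent-false⁻ : {a b : Fin n} → isDescent (just a) (just b) ≡ false → toℕ a ≤ toℕ b
isDescent-false⁻ eq = ≮⇒≥ (λ b<a → subst T eq (<⇒<ᵇ b<a))

-- The selection rules of the two products

min∉⇒descent : (G F : Subset n) {e : Fin n} → minElem G ≡ just e → F ⊆ G - e → Nonempty F →
               F ⊂ G × isDescent (minElem F) (minElem (G ─ F)) ≡ true × minElem (G ─ F) ≡ minElem G
min∉⇒descent G F {e} minG F⊆G-e F≢∅ =
  (F⊆G , e , e∈G , e∉F) , descent , trans minG─F (sym minG)
  where
  e∈G : e ∈ˢ G
  e∈G = minElem-∈ G minG
  e∉F : e ∉ˢ F
  e∉F e∈F = x∈p─q⇒x∉q (F⊆G-e e∈F) (x∈⁅x⁆ e)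
  F⊆G : F ⊆ G
  F⊆G = p─q⊆p G ⁅ e ⁆ ∘ F⊆G-e
  minG─F : minElem (G ─ F) ≡ just e
  minG─F = minElem-unique (G ─ F) (x∈p∧x∉q⇒x∈p─q e∈G e∉F) (minElem-≤ G minG ∘ p─q⊆p G F)
  descent : isDescent (minElem F) (minElem (G ─ F)) ≡ true
  descent with minElem-just F F≢∅
  ... | m , minF = trans (cong₂ isDescent minF minG─F) (isDescent-true (≤∧≢⇒< e≤m e≢m))
    where
    m∈F : m ∈ˢ F
    m∈F = minElem-∈ F minF
    e≤m : toℕ e ≤ toℕ m
    e≤m = minElem-≤ G minG (F⊆G m∈F)
    e≢m : toℕ e ≢ toℕ m
    e≢m e≡m = e∉F (subst (_∈ˢ F) (sym (toℕ-injective e≡m)) m∈F)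

descent⇒min∉ : (G F : Subset n) → F ⊆ G → isDescent (minElem F) (minElem (G ─ F)) ≡ true →
               ∃ λ e → minElem G ≡ just e × F ⊆ G - e × minElem (G ─ F) ≡ minElem G
descent⇒min∉ G F F⊆G descent with isDescent-true⁻ (minElem F) (minElem (G ─ F)) descent
... | f , b , minF , minG─F , b<f = b , minG , F⊆G-b , trans minG─F (sym minG)
  where
  b∈G─F : b ∈ˢ G ─ F
  b∈G─F = minElem-∈ (G ─ F) minG─F
  b∉F : b ∉ˢ F
  b∉F = x∈p─q⇒x∉q b∈G─F
  cover : ∀ {y} → y ∈ˢ G → y ∈ˢ G ─ F ⊎ y ∈ˢ F
  cover {y} y∈G with y ∈? F
  ... | yes y∈F = inj₂ y∈F
  ... | no  y∉F = inj₁ (x∈p∧x∉q⇒x∈p─q y∈G y∉F)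
  minG : minElem G ≡ just b
  minG = minElem-cover (G ─ F) F G cover (p─q⊆p G F b∈G─F) minG─F minF (<⇒≤ b<f)
  F⊆G-b : F ⊆ G - b
  F⊆G-b y∈F = x∈p∧x≢y⇒x∈p-y (F⊆G y∈F) (λ { refl → b∉F y∈F })

min∈⇒ascent : (K F : Subset n) {e : Fin n} → minElem (⊤ ─ K) ≡ just e → K ∪ ⁅ e ⁆ ⊆ F → F ≢ ⊤ →
              K ⊂ F × isDescent (minElem (F ─ K)) (minElem (⊤ ─ F)) ≡ false ×
              minElem (F ─ K) ≡ minElem (⊤ ─ K)
min∈⇒ascent K F {e} min⊤─K K∪e⊆F F≢⊤ =
  (K⊆F , e , e∈F , e∉K) , ascent , trans minF─K (sym min⊤─K)
  where
  e∉K : e ∉ˢ K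
  e∉K = x∈p─q⇒x∉q (minElem-∈ (⊤ ─ K) min⊤─K)
  e∈F : e ∈ˢ F
  e∈F = K∪e⊆F (x∈p∪q⁺ (inj₂ (x∈⁅x⁆ e)))
  K⊆F : K ⊆ F
  K⊆F = K∪e⊆F ∘ x∈p∪q⁺ ∘ inj₁
  minF─K : minElem (F ─ K) ≡ just e
  minF─K = minElem-unique (F ─ K) (x∈p∧x∉q⇒x∈p─q e∈F e∉K)
             (minElem-≤ (⊤ ─ K) min⊤─K ∘ x∈p∧x∉q⇒x∈p─q ∈⊤ ∘ x∈p─q⇒x∉q)
  ascent : isDescent (minElem (F ─ K)) (minElem (⊤ ─ F)) ≡ false
  ascent with minElem-just (⊤ ─ F) (p⊂q⇒q─p≢∅ (p≢⊤⇒p⊂⊤ F≢⊤))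
  ... | b , min⊤─F = trans (cong₂ isDescent minF─K min⊤─F) (isDescent-false e≤b)
    where
    b∉F : b ∉ˢ F
    b∉F = x∈p─q⇒x∉q (minElem-∈ (⊤ ─ F) min⊤─F)
    e≤b : toℕ e ≤ toℕ b
    e≤b = minElem-≤ (⊤ ─ K) min⊤─K (x∈p∧x∉q⇒x∈p─q ∈⊤ (b∉F ∘ K⊆F))

ascent⇒min∈ : (K F : Subset n) → K ⊂ F → F ≢ ⊤ →
              isDescent (minElem (F ─ K)) (minElem (⊤ ─ F)) ≡ false →
              ∃ λ e → minElem (⊤ ─ K) ≡ just e × K ∪ ⁅ e ⁆ ⊆ F × minElem (F ─ K) ≡ minElem (⊤ ─ K)
ascent⇒min∈ K F K⊂F F≢⊤ ascent
  with minElem-just (F ─ K) (p⊂q⇒q─p≢∅ K⊂F) | minElem-just (⊤ ─ F) (p⊂q⇒q─p≢∅ (p≢⊤⇒p⊂⊤ F≢⊤))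
... | a , minF─K | b , min⊤─F = a , min⊤─K , K∪a⊆F , trans minF─K (sym min⊤─K)
  where
  a∈F─K : a ∈ˢ F ─ K
  a∈F─K = minElem-∈ (F ─ K) minF─K
  a∈F : a ∈ˢ F
  a∈F = p─q⊆p F K a∈F─K
  a≤b : toℕ a ≤ toℕ b
  a≤b = isDescent-false⁻ (trans (sym (cong₂ isDescent minF─K min⊤─F)) ascent)
  cover : ∀ {y} → y ∈ˢ ⊤ ─ K → y ∈ˢ F ─ K ⊎ y ∈ˢ ⊤ ─ F
  cover {y} y∈⊤─K with y ∈? F
  ... | yes y∈F = inj₁ (x∈p∧x∉q⇒x∈p─q y∈F (x∈p─q⇒x∉q y∈⊤─K))
  ... | no  y∉F = inj₂ (x∈p∧x∉q⇒x∈p─q ∈⊤ y∉F)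
  min⊤─K : minElem (⊤ ─ K) ≡ just a
  min⊤─K = minElem-cover (F ─ K) (⊤ ─ F) (⊤ ─ K) cover
             (x∈p∧x∉q⇒x∈p─q ∈⊤ (x∈p─q⇒x∉q a∈F─K)) minF─K min⊤─F a≤b
  K∪a⊆F : K ∪ ⁅ a ⁆ ⊆ F
  K∪a⊆F y∈K∪a with x∈p∪q⁻ K ⁅ a ⁆ y∈K∪a
  ... | inj₁ y∈K = proj₁ K⊂F y∈K
  ... | inj₂ y∈a = subst (_∈ˢ F) (sym (x∈⁅y⁆⇒x≡y a y∈a)) a∈F

lastFrom : A → List A → A
lastFrom x []       = x
lastFrom _ (y ∷ ys) = lastFrom y ys

last-∷ : (x : A) (xs : List A) → last (x ∷ xs) ≡ just (lastFrom x xs)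
last-∷ x []       = refl
last-∷ x (y ∷ ys) = last-∷ y ys

lastFrom-∷ʳ : (x : A) (xs : List A) (y : A) → lastFrom x (xs ∷ʳ y) ≡ y
lastFrom-∷ʳ x []       y = refl
lastFrom-∷ʳ x (z ∷ zs) y = lastFrom-∷ʳ z zs y

length-∷ʳ : (xs : List A) (x : A) → length (xs ∷ʳ x) ≡ suc (length xs)
length-∷ʳ xs x = trans (length-++ xs) (+-comm (length xs) 1)

replicate-∷ʳ : (k : ℕ) (x : A) → replicate (suc k) x ≡ replicate k x ∷ʳ x
replicate-∷ʳ zero    x = refl
replicate-∷ʳ (suc k) x = cong (x ∷_) (replicate-∷ʳ k x)

++-replicate-suc : (xs : List A) (k : ℕ) (y : A) →
                   xs ++ replicate (suc k) y ≡ (xs ++ replicate k y) ∷ʳ y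
++-replicate-suc xs k y =
  trans (cong (xs ++_) (replicate-∷ʳ k y)) (sym (++-assoc xs (replicate k y) [ y ]))

module _ {R : A → A → Set} where

  linked-∷ʳ⁺ : {x y : A} {xs : List A} → Linked R (x ∷ xs) → R (lastFrom x xs) y →
               Linked R (x ∷ xs ∷ʳ y)
  linked-∷ʳ⁺ {xs = []}    _         r = r ∷ [-]
  linked-∷ʳ⁺ {xs = _ ∷ _} (r′ ∷ rs) r = r′ ∷ linked-∷ʳ⁺ rs r

  linked-∷ʳ⁻ : {x y : A} {xs : List A} → Linked R (x ∷ xs ∷ʳ y) →
               Linked R (x ∷ xs) × R (lastFrom x xs) y
  linked-∷ʳ⁻ {xs = []}    (r ∷ [-]) = [-] , r
  linked-∷ʳ⁻ {xs = _ ∷ _} (r ∷ rs)  with linked-∷ʳ⁻ rs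
  ... | rs′ , r′ = r ∷ rs′ , r′

∈-concatMap⇔ : (f : A → List B) {xs : List A} {P : A → Set} {Q : B → Set} →
               (∀ {x} → x ∈ xs ⇔ P x) →
               (∀ {x y} → P x → y ∈ f x → Q y) →
               (∀ {y} → Q y → ∃ λ x → P x × y ∈ f x) →
               ∀ {y} → y ∈ concatMap f xs ⇔ Q y
∈-concatMap⇔ f xs⇔P sound complete = mk⇔
  (λ y∈ → let x , x∈xs , y∈fx = find (∈-concatMap⁻ f y∈) in sound (Equivalence.to xs⇔P x∈xs) y∈fx)
  (λ Qy → let x , Px , y∈fx = complete Qy in ∈-concatMap⁺ f (lose (Equivalence.from xs⇔P Px) y∈fx))

concatMap-unique : (f : A → List B) {xs : List A} → (∀ x → Unique (f x)) →
                   (∀ {x x′ y} → y ∈ f x → y ∈ f x′ → x ≡ x′) → Unique xs → Unique (concatMap f xs)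
concatMap-unique f {xs} f-unique f-disjoint xs-unique =
  Unique.concat⁺ (All.map⁺ (universal f-unique xs))
    (AllPairs.map⁺ (AllPairs.map (λ x≢x′ {_} (y∈fx , y∈fx′) → x≢x′ (f-disjoint y∈fx y∈fx′))
                                 xs-unique))

∈-allSubsets : (X : Subset n) → X ∈ allSubsets n
∈-allSubsets []            = here refl
∈-allSubsets (inside ∷ X)  = ∈-++⁺ˡ (∈-map⁺ (inside ∷_) (∈-allSubsets X))
∈-allSubsets {suc n} (outside ∷ X) =
  ∈-++⁺ʳ (map (inside ∷_) (allSubsets n)) (∈-map⁺ (outside ∷_) (∈-allSubsets X))

allSubsets-unique : ∀ n → Unique (allSubsets n)
allSubsets-unique zero    = [] ∷ []
allSubsets-unique (suc n) =
  Unique.++⁺ (Unique.map⁺ Vec.∷-injectiveʳ (allSubsets-unique n))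
             (Unique.map⁺ Vec.∷-injectiveʳ (allSubsets-unique n))
             disjoint
  where
  disjoint : ∀ {X} → ¬ (X ∈ map (inside ∷_) (allSubsets n) × X ∈ map (outside ∷_) (allSubsets n))
  disjoint (X∈ , X∈′) with ∈-map⁻ (inside ∷_) X∈ | ∈-map⁻ (outside ∷_) X∈′
  ... | _ , _ , refl | _ , _ , ()

-- Words and flags

wordTail : Flag n → List (Maybe (Fin n))
wordTail []      = []
wordTail (G ∷ L) = wordFrom G L

wordInit : Subset n → Flag n → List (Maybe (Fin n))
wordInit P []      = []
wordInit P (F ∷ L) = minElem (F ─ P) ∷ wordInit F L

wordFrom-wordInit : (P : Subset n) (L : Flag n) →
                    wordFrom P L ≡ wordInit P L ∷ʳ minElem (⊤ ─ lastFrom P L)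
wordFrom-wordInit P []      = refl
wordFrom-wordInit P (F ∷ L) = cong (minElem (F ─ P) ∷_) (wordFrom-wordInit F L)

wordInit-∷ʳ : (P : Subset n) (L : Flag n) (F : Subset n) →
              wordInit P (L ∷ʳ F) ≡ wordInit P L ∷ʳ minElem (F ─ lastFrom P L)
wordInit-∷ʳ P []      F = refl
wordInit-∷ʳ P (G ∷ L) F = cong (minElem (G ─ P) ∷_) (wordInit-∷ʳ G L F)

descents-∷ʳ : (u : List (Maybe (Fin n))) (a b : Maybe (Fin n)) →
              descents (u ∷ʳ a ∷ʳ b) ≡ descents (u ∷ʳ a) ∷ʳ isDescent a b
descents-∷ʳ []          a b = refl
descents-∷ʳ (x ∷ [])    a b = refl
descents-∷ʳ (x ∷ y ∷ u) a b = cong (isDescent x y ∷_) (descents-∷ʳ (y ∷ u) a b)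

module _ (M : Matroid n) where

  lastFlat≡lastFrom : (L : Flag n) → lastFlat M L ≡ lastFrom ⊥ L
  lastFlat≡lastFrom []      = refl
  lastFlat≡lastFrom (F ∷ L) with last (F ∷ L) | last-∷ F L
  ... | _ | refl = refl

  wordFrom-firstFlat : (P : Subset n) (L : Flag n) →
                       wordFrom P L ≡ minElem (firstFlat M L ─ P) ∷ wordTail L
  wordFrom-firstFlat P []      = refl
  wordFrom-firstFlat P (G ∷ L) = refl

  word-firstFlat : (L : Flag n) → word L ≡ minElem (firstFlat M L) ∷ wordTail L
  word-firstFlat L =
    trans (wordFrom-firstFlat ⊥ L) (cong (λ X → minElem X ∷ wordTail L) (p─⊥≡p (firstFlat M L)))

  word-∷ : (F : Subset n) (L : Flag n) →
           word (F ∷ L) ≡ minElem F ∷ minElem (firstFlat M L ─ F) ∷ wordTail L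
  word-∷ F L = cong₂ _∷_ (cong minElem (p─⊥≡p F)) (wordFrom-firstFlat F L)

  word-lastFlat : (L : Flag n) → word L ≡ wordInit ⊥ L ∷ʳ minElem (⊤ ─ lastFlat M L)
  word-lastFlat L rewrite lastFlat≡lastFrom L = wordFrom-wordInit ⊥ L

  descents-word-∷ʳ : (L : Flag n) (F : Subset n) →
    let m = minElem (F ─ lastFlat M L) in
    descents (word (L ∷ʳ F)) ≡ descents (wordInit ⊥ L ∷ʳ m) ∷ʳ isDescent m (minElem (⊤ ─ F))
  descents-word-∷ʳ L F rewrite lastFlat≡lastFrom L
                             | wordFrom-wordInit ⊥ (L ∷ʳ F)
                             | wordInit-∷ʳ ⊥ L F
                             | lastFrom-∷ʳ ⊥ L F =
    descents-∷ʳ (wordInit ⊥ L) (minElem (F ─ lastFrom ⊥ L)) (minElem (⊤ ─ F))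

  isFlag-∷ : {F : Subset n} (L : Flag n) → IsFlag M L → NonemptyFlat M F → F ⊂ firstFlat M L →
             IsFlag M (F ∷ L)
  isFlag-∷ []      _               (flat , ne) F⊂⊤ = (flat , ne , p⊂q⇒p≢⊤ F⊂⊤) ∷ [] , [-]
  isFlag-∷ (G ∷ L) (flats , chain) (flat , ne) F⊂G =
    (flat , ne , p⊂q⇒p≢⊤ F⊂G) ∷ flats , F⊂G ∷ chain

  isFlag-∷⁻ : {F : Subset n} (L : Flag n) → IsFlag M (F ∷ L) →
              IsFlag M L × NonemptyProperFlat M F × F ⊂ firstFlat M L
  isFlag-∷⁻ []      (F-flat@(_ , _ , F≢⊤) ∷ [] , _)   = ([] , []) , F-flat , p≢⊤⇒p⊂⊤ F≢⊤
  isFlag-∷⁻ (G ∷ L) (F-flat ∷ flats , F⊂G ∷ chain) = (flats , chain) , F-flat , F⊂G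

  isFlag-∷ʳ : {F : Subset n} (L : Flag n) → IsFlag M L → NonemptyProperFlat M F →
              lastFlat M L ⊂ F → IsFlag M (L ∷ʳ F)
  isFlag-∷ʳ []          _               F-flat _   = F-flat ∷ [] , [-]
  isFlag-∷ʳ {F} (G ∷ L) (flats , chain) F-flat K⊂F =
    All.++⁺ flats (F-flat ∷ []) ,
    linked-∷ʳ⁺ chain (subst (_⊂ F) (lastFlat≡lastFrom (G ∷ L)) K⊂F)

  isFlag-∷ʳ⁻ : {F : Subset n} (L : Flag n) → IsFlag M (L ∷ʳ F) →
               IsFlag M L × NonemptyProperFlat M F × lastFlat M L ⊂ F
  isFlag-∷ʳ⁻ [] (F-flat@(_ , (x , x∈F) , _) ∷ [] , _) = ([] , []) , F-flat , (⊥⊆ , x , x∈F , ∉⊥)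
  isFlag-∷ʳ⁻ {F} (G ∷ L) (flats , chain) with All.++⁻ (G ∷ L) flats | linked-∷ʳ⁻ chain
  ... | flatsL , F-flat ∷ [] | chainL , K⊂F =
    (flatsL , chainL) , F-flat , subst (_⊂ F) (sym (lastFlat≡lastFrom (G ∷ L))) K⊂F

  nonemptyFlats nonemptyProperFlats : List (Subset n)
  nonemptyFlats       = filter (nonemptyFlat? M) (allSubsets n)
  nonemptyProperFlats = filter (nonemptyProperFlat? M) (allSubsets n)

  ∈-mulβ⁻ : (L 𝓕 : Flag n) → 𝓕 ∈ mulβ M L →
            ∃₂ λ e F → minElem (firstFlat M L) ≡ just e × 𝓕 ≡ F ∷ L ×
                       NonemptyFlat M F × F ⊆ firstFlat M L - e
  ∈-mulβ⁻ L 𝓕 𝓕∈ with minElem (firstFlat M L)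
  ... | just e with ∈-map⁻ (_∷ L) 𝓕∈
  ... | F , F∈ , refl with ∈-filter⁻ (_⊆? (firstFlat M L - e)) {xs = nonemptyFlats} F∈
  ... | F∈′ , F⊆G-e =
    e , F , refl , refl , proj₂ (∈-filter⁻ (nonemptyFlat? M) {xs = allSubsets n} F∈′) , F⊆G-e

  ∈-mulβ⁺ : (L : Flag n) {e : Fin n} {F : Subset n} → minElem (firstFlat M L) ≡ just e →
            NonemptyFlat M F → F ⊆ firstFlat M L - e → F ∷ L ∈ mulβ M L
  ∈-mulβ⁺ L minG F-flat F⊆G-e with minElem (firstFlat M L)
  ∈-mulβ⁺ L {e} {F} refl F-flat F⊆G-e | just e =
    ∈-map⁺ (_∷ L) (∈-filter⁺ (_⊆? (firstFlat M L - e))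
      (∈-filter⁺ (nonemptyFlat? M) (∈-allSubsets F) F-flat) F⊆G-e)

  ∈-mulα⁻ : (L 𝓕 : Flag n) → 𝓕 ∈ mulα M L →
            ∃₂ λ e F → minElem (⊤ ─ lastFlat M L) ≡ just e × 𝓕 ≡ L ∷ʳ F ×
                       NonemptyProperFlat M F × lastFlat M L ∪ ⁅ e ⁆ ⊆ F
  ∈-mulα⁻ L 𝓕 𝓕∈ with minElem (∁ (lastFlat M L)) in min∁K
  ... | just e with ∈-map⁻ (L ∷ʳ_) 𝓕∈
  ... | F , F∈ , refl with ∈-filter⁻ ((lastFlat M L ∪ ⁅ e ⁆) ⊆?_) {xs = nonemptyProperFlats} F∈
  ... | F∈′ , K∪e⊆F =
    e , F , trans (cong minElem (⊤─p≡∁p (lastFlat M L))) min∁K , refl ,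
    proj₂ (∈-filter⁻ (nonemptyProperFlat? M) {xs = allSubsets n} F∈′) , K∪e⊆F

  ∈-mulα⁺ : (L : Flag n) {e : Fin n} {F : Subset n} → minElem (⊤ ─ lastFlat M L) ≡ just e →
            NonemptyProperFlat M F → lastFlat M L ∪ ⁅ e ⁆ ⊆ F → L ∷ʳ F ∈ mulα M L
  ∈-mulα⁺ L {F = F} min⊤─K F-flat K∪e⊆F
    with minElem (∁ (lastFlat M L)) | trans (sym (cong minElem (⊤─p≡∁p (lastFlat M L)))) min⊤─K
  ... | just e | refl =
    ∈-map⁺ (L ∷ʳ_) (∈-filter⁺ ((lastFlat M L ∪ ⁅ e ⁆) ⊆?_)
      (∈-filter⁺ (nonemptyProperFlat? M) (∈-allSubsets F) F-flat) K∪e⊆F)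

  mulβ-unique : (L : Flag n) → Unique (mulβ M L)
  mulβ-unique L with minElem (firstFlat M L)
  ... | nothing = []
  ... | just e  = Unique.map⁺ ∷-injectiveˡ
                    (Unique.filter⁺ (_⊆? (firstFlat M L - e))
                      (Unique.filter⁺ (nonemptyFlat? M) (allSubsets-unique n)))

  mulα-unique : (L : Flag n) → Unique (mulα M L)
  mulα-unique L with minElem (∁ (lastFlat M L))
  ... | nothing = []
  ... | just e  = Unique.map⁺ (∷ʳ-injectiveʳ L L)
                    (Unique.filter⁺ ((lastFlat M L ∪ ⁅ e ⁆) ⊆?_)
                      (Unique.filter⁺ (nonemptyProperFlat? M) (allSubsets-unique n)))

  -- The lexicographic expansion

  DescentFlag : ℕ → ℕ → Flag n → Set
  DescentFlag s t 𝓕 =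
    IsFlag M 𝓕 × length 𝓕 ≡ s + t × descents (word 𝓕) ≡ replicate t true ++ replicate s false

  mulβ-sound : (t : ℕ) {L 𝓕 : Flag n} → DescentFlag 0 t L → 𝓕 ∈ mulβ M L → DescentFlag 0 (suc t) 𝓕
  mulβ-sound t {L} (L-flag , len , ds) 𝓕∈ with ∈-mulβ⁻ L _ 𝓕∈
  ... | e , F , minG , refl , F-flat , F⊆G-e
    with min∉⇒descent (firstFlat M L) F minG F⊆G-e (proj₂ F-flat)
  ... | F⊂G , descent , minG─F =
    isFlag-∷ L L-flag F-flat F⊂G , cong suc len , ds-𝓕
    where
    open ≡-Reasoning
    G = firstFlat M L
    ds-𝓕 : descents (word (F ∷ L)) ≡ replicate (suc t) true ++ []
    ds-𝓕 = begin
      descents (word (F ∷ L))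
        ≡⟨ cong descents (word-∷ F L) ⟩
      isDescent (minElem F) (minElem (G ─ F)) ∷ descents (minElem (G ─ F) ∷ wordTail L)
        ≡⟨ cong₂ _∷_ descent (cong (λ m → descents (m ∷ wordTail L)) minG─F) ⟩
      true ∷ descents (minElem G ∷ wordTail L)
        ≡⟨ cong (λ w → true ∷ descents w) (word-firstFlat L) ⟨
      true ∷ descents (word L)
        ≡⟨ cong (true ∷_) ds ⟩
      replicate (suc t) true ++ [] ∎

  mulβ-complete : (t : ℕ) {𝓕 : Flag n} → DescentFlag 0 (suc t) 𝓕 →
                  ∃ λ L → DescentFlag 0 t L × 𝓕 ∈ mulβ M L
  mulβ-complete t {F ∷ L} (𝓕-flag , len , ds) with isFlag-∷⁻ L 𝓕-flag
  ... | L-flag , (flat , ne , _) , F⊂G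
    with ∷-injective (trans (sym (cong descents (word-∷ F L))) ds)
  ... | descent , ds-tail
    with descent⇒min∉ (firstFlat M L) F (proj₁ F⊂G) descent
  ... | e , minG , F⊆G-e , minG─F =
    L , (L-flag , suc-injective len , dsL) , ∈-mulβ⁺ L minG (flat , ne) F⊆G-e
    where
    dsL : descents (word L) ≡ replicate t true ++ []
    dsL = trans (cong descents (trans (word-firstFlat L) (cong (_∷ wordTail L) (sym minG─F))))
                ds-tail

  mulα-sound : (s t : ℕ) {L 𝓕 : Flag n} → DescentFlag s t L → 𝓕 ∈ mulα M L →
               DescentFlag (suc s) t 𝓕
  mulα-sound s t {L} (L-flag , len , ds) 𝓕∈ with ∈-mulα⁻ L _ 𝓕∈
  ... | e , F , min⊤─K , refl , F-flat , K∪e⊆F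
    with min∈⇒ascent (lastFlat M L) F min⊤─K K∪e⊆F (proj₂ (proj₂ F-flat))
  ... | K⊂F , ascent , minF─K =
    isFlag-∷ʳ L L-flag F-flat K⊂F , trans (length-∷ʳ L F) (cong suc len) , ds-𝓕
    where
    open ≡-Reasoning
    K = lastFlat M L
    ds-𝓕 : descents (word (L ∷ʳ F)) ≡ replicate t true ++ replicate (suc s) false
    ds-𝓕 = begin
      descents (word (L ∷ʳ F))
        ≡⟨ descents-word-∷ʳ L F ⟩
      descents (wordInit ⊥ L ∷ʳ minElem (F ─ K)) ∷ʳ isDescent (minElem (F ─ K)) (minElem (⊤ ─ F))
        ≡⟨ cong₂ _∷ʳ_ (cong (λ m → descents (wordInit ⊥ L ∷ʳ m)) minF─K) ascent ⟩
      descents (wordInit ⊥ L ∷ʳ minElem (⊤ ─ K)) ∷ʳ false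
        ≡⟨ cong (λ w → descents w ∷ʳ false) (word-lastFlat L) ⟨
      descents (word L) ∷ʳ false
        ≡⟨ cong (_∷ʳ false) ds ⟩
      (replicate t true ++ replicate s false) ∷ʳ false
        ≡⟨ ++-replicate-suc (replicate t true) s false ⟨
      replicate t true ++ replicate (suc s) false ∎

  mulα-complete : (s t : ℕ) {𝓕 : Flag n} → DescentFlag (suc s) t 𝓕 →
                  ∃ λ L → DescentFlag s t L × 𝓕 ∈ mulα M L
  mulα-complete s t {𝓕} _ with initLast 𝓕
  mulα-complete s t (_ , () , _) | []
  mulα-complete s t (𝓕-flag , len , ds) | L ∷ʳ′ F with isFlag-∷ʳ⁻ L 𝓕-flag
  ... | L-flag , F-flat , K⊂F
    with ∷ʳ-injective _ _ (trans (sym (descents-word-∷ʳ L F))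
                                 (trans ds (++-replicate-suc (replicate t true) s false)))
  ... | ds-init , ascent
    with ascent⇒min∈ (lastFlat M L) F K⊂F (proj₂ (proj₂ F-flat)) ascent
  ... | e , min⊤─K , K∪e⊆F , minF─K =
    L , (L-flag , suc-injective (trans (sym (length-∷ʳ L F)) len) , dsL) ,
    ∈-mulα⁺ L min⊤─K F-flat K∪e⊆F
    where
    dsL : descents (word L) ≡ replicate t true ++ replicate s false
    dsL = trans (cong descents (trans (word-lastFlat L) (cong (wordInit ⊥ L ∷ʳ_) (sym minF─K))))
                ds-init

  ∈-mulβ-injective : {L L′ 𝓕 : Flag n} → 𝓕 ∈ mulβ M L → 𝓕 ∈ mulβ M L′ → L ≡ L′
  ∈-mulβ-injective {L} {L′} 𝓕∈ 𝓕∈′ with ∈-mulβ⁻ L _ 𝓕∈ | ∈-mulβ⁻ L′ _ 𝓕∈′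
  ... | _ , _ , _ , refl , _ | _ , _ , _ , 𝓕≡ , _ = ∷-injectiveʳ 𝓕≡

  ∈-mulα-injective : {L L′ 𝓕 : Flag n} → 𝓕 ∈ mulα M L → 𝓕 ∈ mulα M L′ → L ≡ L′
  ∈-mulα-injective {L} {L′} 𝓕∈ 𝓕∈′ with ∈-mulα⁻ L _ 𝓕∈ | ∈-mulα⁻ L′ _ 𝓕∈′
  ... | _ , _ , _ , refl , _ | _ , _ , _ , 𝓕≡ , _ = ∷ʳ-injectiveˡ L L′ 𝓕≡

  ∈-iterβ : (t : ℕ) {𝓕 : Flag n} → 𝓕 ∈ iterβ M t ([] ∷ []) ⇔ DescentFlag 0 t 𝓕
  ∈-iterβ zero    {[]}    = mk⇔ (λ _ → ([] , []) , refl , refl) (λ _ → here refl)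
  ∈-iterβ zero    {_ ∷ _} = mk⇔ (λ { (here ()) ; (there ()) }) (λ { (_ , () , _) })
  ∈-iterβ (suc t)         = ∈-concatMap⇔ (mulβ M) (∈-iterβ t) (mulβ-sound t) (mulβ-complete t)

  ∈-lexExpansion : (s t : ℕ) {𝓕 : Flag n} → 𝓕 ∈ lexExpansion M s t ⇔ DescentFlag s t 𝓕
  ∈-lexExpansion zero    t = ∈-iterβ t
  ∈-lexExpansion (suc s) t =
    ∈-concatMap⇔ (mulα M) (∈-lexExpansion s t) (mulα-sound s t) (mulα-complete s t)

  iterβ-unique : (t : ℕ) → Unique (iterβ M t ([] ∷ []))
  iterβ-unique zero    = [] ∷ []
  iterβ-unique (suc t) = concatMap-unique (mulβ M) mulβ-unique ∈-mulβ-injective (iterβ-unique t)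

  lexExpansion-unique : (s t : ℕ) → Unique (lexExpansion M s t)
  lexExpansion-unique zero    t = iterβ-unique t
  lexExpansion-unique (suc s) t =
    concatMap-unique (mulα M) mulα-unique ∈-mulα-injective (lexExpansion-unique s t)

-- The identity is purely combinatorial: it holds for every matroid.
mainTheorem1 : ∀ {n r : ℕ} (M : Matroid n) → Loopless M → rk M ⊤ ≡ suc r →
    (s t : ℕ) →
    Unique (lexExpansion M s t) ×
    (∀ (𝓕 : Flag n) → (𝓕 ∈ lexExpansion M s t) ⇔
      (IsFlag M 𝓕 × length 𝓕 ≡ s + t ×
       descents (word 𝓕) ≡ replicate t true ++ replicate s false))
mainTheorem1 M _ _ s t = lexExpansion-unique M s t , λ 𝓕 → ∈-lexExpansion M s t
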